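{- For every positive real number $M$ there exist a connected graph $G$ and a vertex $v\in V(G)$ such that $\dfrac{\chi_d^t(G)}{\chi_d^t(G\odot v)}\geq M$; that is, this ratio can be arbitrarily large.
   Context: All graphs are simple and finite. For a graph with no isolated vertex, a total dominator coloring (TD-coloring) is a proper vertex coloring in which every vertex is adjacent to every vertex of some color class (a class other than its own); $\chi_d^t$ denotes the minimum number of colors in such a coloring. $G\odot v$ denotes the graph obtained from $G$ by removing all edges between pairs of neighbours of $v$ (the vertex $v$ itself is not removed). -}

module Defs where

open import Data.Nat using (ℕ; _<_)
open import Data.Fin using (Fin)
open import Data.Bool using (Bool; true; false; _∧_; not)
open import Data.Bool.Properties using (∧-comm)
open import Data.Product using (Σ; ∃; _×_; _,_)
open import Relation.Binary.PropositionalEquality using (_≡_; _≢_; refl; cong₂; trans)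
open import Relation.Nullary using (¬_)

record Graph : Set where
  field
    n      : ℕ
    adj    : Fin n → Fin n → Bool
    symm   : ∀ i j → adj i j ≡ adj j i
    irrefl : ∀ i → adj i i ≡ false
open Graph public

Edge : (G : Graph) → Fin (n G) → Fin (n G) → Set
Edge G i j = adj G i j ≡ true

data Reach (G : Graph) : Fin (n G) → Fin (n G) → Set where
  here : ∀ {i} → Reach G i i
  step : ∀ {i j k} → Edge G i j → Reach G j k → Reach G i k

Connected : Graph → Set
Connected G = (0 < n G) × (∀ i j → Reach G i j)

NoIsolated : Graph → Set
NoIsolated G = ∀ i → ∃ λ j → Edge G i j

Coloring : Graph → ℕ → Set
Coloring G k = Fin (n G) → Fin k

Proper : (G : Graph) {k : ℕ} → Coloring G k → Set
Proper G c = ∀ i j → Edge G i j → c i ≢ c j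

TotalDominating : (G : Graph) {k : ℕ} → Coloring G k → Set
TotalDominating G {k} c =
  ∀ i → Σ (Fin k) λ col →
    (col ≢ c i) × (∃ λ j → c j ≡ col) × (∀ j → c j ≡ col → Edge G i j)

IsTDColoring : (G : Graph) {k : ℕ} → Coloring G k → Set
IsTDColoring G c = Proper G c × TotalDominating G c

IsTDChromaticNumber : Graph → ℕ → Set
IsTDChromaticNumber G m =
  (Σ (Coloring G m) λ c → IsTDColoring G c) ×
  (∀ k → k < m → ¬ (Σ (Coloring G k) λ c → IsTDColoring G c))

odot : (G : Graph) → Fin (n G) → Graph
odot G v = record
  { n      = n G
  ; adj    = λ i j → adj G i j ∧ not (adj G v i ∧ adj G v j)
  ; symm   = λ i j → cong₂ _∧_ (symm G i j) (cong not (∧-comm (adj G v i) (adj G v j)))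
  ; irrefl = λ i → irr i
  }
  where
  open import Relation.Binary.PropositionalEquality using (cong)
  irr : ∀ i → (adj G i i ∧ not (adj G v i ∧ adj G v i)) ≡ false
  irr i rewrite irrefl G i = refl

-- In the complete graph K_m every proper colouring is injective, so χ_d^t(K_m) = m,
-- while the identity colouring is a TD-colouring as soon as m ≥ 2. Removing the edges
-- between the neighbours of a vertex of K_m leaves the star K_{1,m-1}, and colouring
-- its centre and its leaves apart is a TD-colouring; since every TD-colouring needs
-- two colours, χ_d^t(K_m ⊙ v) = 2. Taking m = 2M + 2 gives the ratio M + 1.
module Submission where

open import Defs
open import Data.Nat using (ℕ; zero; suc; _+_; _*_; _≥_; _≤_; _<_; s≤s; z≤n)
open import Data.Nat.Properties using (_<?_; <⇒≱; ≮⇒≥; m≤n+m)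
open import Data.Fin using (Fin; zero; suc; _≟_)
open import Data.Fin.Properties using (pigeonhole; <⇒≢)
open import Data.Bool using (true; false; not; _∧_)
open import Data.Bool.Properties using (∧-zeroʳ)
open import Data.Product using (Σ; _×_; _,_)
open import Function using (id; _∘_)
open import Relation.Nullary using (¬_; yes; no; does; contradiction)
open import Relation.Nullary.Decidable using (dec-true; dec-false)
open import Relation.Binary.PropositionalEquality using (_≡_; _≢_; refl; sym; trans; cong)

tdColoring-needs-two-colors : ∀ {G k} (c : Coloring G k) → TotalDominating G c →
                              Fin (n G) → 2 ≤ k
tdColoring-needs-two-colors {k = zero}        c td i with c i
... | ()
tdColoring-needs-two-colors {k = suc zero}    c td i with td i
... | col , col≢ci , _ = contradiction (trans (unique col) (sym (unique (c i)))) col≢ci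
  where
  unique : (a : Fin 1) → a ≡ zero
  unique zero = refl
tdColoring-needs-two-colors {k = suc (suc _)} c td i = s≤s (s≤s z≤n)

isTDChromaticNumber-two : ∀ {G} (c : Coloring G 2) → IsTDColoring G c → Fin (n G) →
                          IsTDChromaticNumber G 2
isTDChromaticNumber-two {G} c isTD i =
  (c , isTD) , λ k k<2 (c′ , _ , td) → <⇒≱ k<2 (tdColoring-needs-two-colors {G} c′ td i)

does-≟-sym : ∀ {m} (i j : Fin m) → does (i ≟ j) ≡ does (j ≟ i)
does-≟-sym i j with i ≟ j
... | yes i≡j = sym (dec-true (j ≟ i) (sym i≡j))
... | no  i≢j = sym (dec-false (j ≟ i) (i≢j ∘ sym))

complete : ℕ → Graph
complete m = record
  { n      = m
  ; adj    = λ i j → not (does (i ≟ j))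
  ; symm   = λ i j → cong not (does-≟-sym i j)
  ; irrefl = λ i → cong not (dec-true (i ≟ i) refl)
  }

complete-edge : ∀ {m} {i j : Fin m} → i ≢ j → Edge (complete m) i j
complete-edge {i = i} {j} i≢j = cong not (dec-false (i ≟ j) i≢j)

complete-edge⇒≢ : ∀ {m} {i j : Fin m} → Edge (complete m) i j → i ≢ j
complete-edge⇒≢ {i = i} e refl with trans (sym e) (cong not (dec-true (i ≟ i) refl))
... | ()

complete-connected : ∀ {m} → 0 < m → Connected (complete m)
complete-connected 0<m = 0<m , walk
  where
  walk : ∀ i j → Reach (complete _) i j
  walk i j with i ≟ j
  ... | yes refl = here
  ... | no  i≢j  = step (complete-edge i≢j) here

complete-noIsolated : ∀ {k} → NoIsolated (complete (suc (suc k)))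
complete-noIsolated zero    = suc zero , refl
complete-noIsolated (suc i) = zero , refl

proper-complete⇒colors≥ : ∀ {m k} (c : Coloring (complete m) k) →
                          Proper (complete m) c → m ≤ k
proper-complete⇒colors≥ {m} {k} c proper with k <? m
... | no  k≮m = ≮⇒≥ k≮m
... | yes k<m with pigeonhole k<m c
...   | i , j , i<j , ci≡cj = contradiction ci≡cj (proper i j (complete-edge (<⇒≢ i<j)))

complete-id-isTDColoring : ∀ {m} → NoIsolated (complete m) → IsTDColoring (complete m) id
complete-id-isTDColoring noIsolated = (λ i j → complete-edge⇒≢) , dominating
  where
  dominating : TotalDominating (complete _) id
  dominating i with noIsolated i
  ... | j , i~j = j , complete-edge⇒≢ i~j ∘ sym , (j , refl) , λ { _ refl → i~j }

complete-isTDChromaticNumber : ∀ {k} →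
  IsTDChromaticNumber (complete (suc (suc k))) (suc (suc k))
complete-isTDChromaticNumber =
  (id , complete-id-isTDColoring complete-noIsolated) ,
  λ k k<m (c , proper , _) → <⇒≱ k<m (proper-complete⇒colors≥ c proper)

star : ℕ → Graph
star m = odot (complete (suc m)) zero

star-leaves-nonadjacent : ∀ {m} (i j : Fin m) → ¬ Edge (star m) (suc i) (suc j)
star-leaves-nonadjacent i j e with trans (sym (∧-zeroʳ _)) e
... | ()

star-noIsolated : ∀ {k} → NoIsolated (star (suc k))
star-noIsolated zero    = suc zero , refl
star-noIsolated (suc i) = zero , refl

centre-leaves : ∀ {m} → Coloring (star m) 2
centre-leaves zero    = zero
centre-leaves (suc _) = suc zero

centre-leaves-isTDColoring : ∀ {k} → IsTDColoring (star (suc k)) centre-leaves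
centre-leaves-isTDColoring = proper , dominating
  where
  proper : Proper (star _) centre-leaves
  proper zero    zero    ()
  proper zero    (suc j) e  = λ ()
  proper (suc i) zero    e  = λ ()
  proper (suc i) (suc j) e  = contradiction e (star-leaves-nonadjacent i j)

  dominating : TotalDominating (star _) centre-leaves
  dominating zero    = suc zero , (λ ()) , (suc zero , refl) , λ { (suc j) _ → refl }
  dominating (suc i) = zero     , (λ ()) , (zero , refl)     , λ { zero _ → refl }

star-isTDChromaticNumber : ∀ {k} → IsTDChromaticNumber (star (suc k)) 2
star-isTDChromaticNumber {k} = isTDChromaticNumber-two {star (suc k)} centre-leaves centre-leaves-isTDColoring zero

corollary3p6 : (M : ℕ) →
    Σ Graph λ G → Σ (Fin (n G)) λ v →
      Connected G × NoIsolated G × NoIsolated (odot G v) ×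
      Σ ℕ λ a → Σ ℕ λ b →
        IsTDChromaticNumber G a × IsTDChromaticNumber (odot G v) b × (a ≥ M * b)
corollary3p6 M =
  complete m , zero ,
  complete-connected (s≤s z≤n) , complete-noIsolated , star-noIsolated ,
  m , 2 , complete-isTDChromaticNumber , star-isTDChromaticNumber , m≤n+m (M * 2) 2
  where
  m : ℕ
  m = 2 + M * 2
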